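{- For any graph $G$ as in the context and any chip configuration $D\ge 0$ on $G$, $D$ has exactly one $0$-stabilization.
   Context: Let $a,b,c$ be positive integers. Let $G$ be a simple undirected graph with vertex set $\{0\}\cup[n]$ ($0$ is the sink) such that $\{0,i\}$ is an edge for every $i\in[n]$. For $i\in[n]$ let $N(i)$ be the set of non-sink vertices adjacent to $i$ and $\deg(i)=|N(i)|$. A chip configuration is $D:[n]\to\mathbb{Z}$; $D\ge0$ means all values are nonnegative. The firing move $\phi_i$ sends $D$ to the configuration obtained by subtracting $c+\lfloor \deg(i)\,a/b\rfloor$ from $D(i)$ and adding $\lfloor a/b\rfloor$ to $D(j)$ for each $j\in N(i)$; it is legal on $D\ge0$ if $\phi_i(D)\ge 0$. A configuration $D\ge 0$ is $0$-stable if no $\phi_i$ is legal on it. A $0$-stabilization of $D\ge 0$ is a $0$-stable configuration obtained from $D$ by a finite sequence of single-vertex firing moves, each legal on the configuration to which it is applied. -}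

module Defs where

open import Data.Nat as ℕ using (ℕ; _/_; NonZero)
open import Data.Integer as ℤ using (ℤ; +_; _+_; _-_)
open import Data.Fin using (Fin; _≟_)
open import Data.Bool using (Bool; true; false; if_then_else_)
open import Data.List using (map; allFin)
open import Data.Nat.ListAction using (sum)
open import Data.Product using (Σ; _×_)
open import Relation.Nullary using (¬_; yes; no)
open import Relation.Binary.PropositionalEquality using (_≡_)

-- A simple graph on the non-sink vertices [n] = Fin n.  The sink 0 is
-- implicit: it is adjacent to every non-sink vertex and plays no further role.
record Graph (n : ℕ) : Set where
  field
    adj    : Fin n → Fin n → Bool
    sym    : ∀ i j → adj i j ≡ adj j i
    irrefl : ∀ i → adj i i ≡ false
open Graph public

deg : ∀ {n} → Graph n → Fin n → ℕ
deg {n} G i = sum (map (λ j → if adj G i j then 1 else 0) (allFin n))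

Config : ℕ → Set
Config n = Fin n → ℤ

NonNeg : ∀ {n} → Config n → Set
NonNeg D = ∀ i → + 0 ℤ.≤ D i

fire : (a b c : ℕ) .{{_ : NonZero b}} → ∀ {n} → Graph n → Fin n → Config n → Config n
fire a b c G i D j with i ≟ j
... | yes _ = D j - + (c ℕ.+ (deg G i ℕ.* a) / b)
... | no _  = if adj G i j then D j + + (a / b) else D j

Legal : (a b c : ℕ) .{{_ : NonZero b}} → ∀ {n} → Graph n → Fin n → Config n → Set
Legal a b c G i D = NonNeg (fire a b c G i D)

ZeroStable : (a b c : ℕ) .{{_ : NonZero b}} → ∀ {n} → Graph n → Config n → Set
ZeroStable a b c G D = NonNeg D × (∀ i → ¬ Legal a b c G i D)

data LegalFirings (a b c : ℕ) .{{_ : NonZero b}} {n : ℕ} (G : Graph n)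
     : Config n → Config n → Set where
  done : ∀ {D} → LegalFirings a b c G D D
  step : ∀ {D E} i → Legal a b c G i D
       → LegalFirings a b c G (fire a b c G i D) E → LegalFirings a b c G D E

ZeroStabilization : (a b c : ℕ) .{{_ : NonZero b}} → ∀ {n} → Graph n
                  → Config n → Config n → Set
ZeroStabilization a b c G D E = LegalFirings a b c G D E × ZeroStable a b c G E

{-# OPTIONS --safe #-}
-- Firing i adds a fixed vector Δ i to the configuration, so firings commute,
-- and Δ j is nonnegative away from j, so a firing that is legal stays legal
-- after another vertex fires.  Hence a firing that is legal at D can be moved
-- to the front of any stabilizing sequence from D, and induction on that
-- sequence shows that all 0-stabilizations coincide.  Existence: each firing
-- lowers the total number of chips, by at least c ≥ 1 because
-- deg(i)⌊a/b⌋ ≤ ⌊deg(i)a/b⌋, so firing legal vertices greedily terminates.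
module Submission where

open import Defs hiding (sym)
open import Data.Nat using (ℕ; _<_; NonZero)
open import Data.Fin using (Fin)
open import Data.Product using (Σ; _×_)
open import Relation.Binary.PropositionalEquality using (_≡_)

open import Data.Bool using (true; false; if_then_else_)
open import Data.Fin using (zero; suc; _≟_; punchIn)
open import Data.Fin.Properties using (any?; all?; punchInᵢ≢i)
open import Data.Integer using (ℤ; +_; 0ℤ; -_; _+_; _*_; _≤_; _≤?_; +≤+; +<+; ∣_∣)
  renaming (_<_ to _<ℤ_)
import Data.Integer.Properties as ℤ
open import Data.List using (tabulate)
open import Data.List.Properties using (map-tabulate)
import Data.Nat as ℕ
import Data.Nat.DivMod as ℕ
import Data.Nat.ListAction as List
import Data.Nat.Properties as ℕ
open import Data.Nat.Induction using (<-wellFounded)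
open import Data.Product using (_,_)
open import Function using (_∘_)
open import Induction.WellFounded using (Acc; acc)
open import Relation.Binary.PropositionalEquality
  using (_≢_; _≗_; refl; sym; trans; cong; module ≡-Reasoning)
open import Relation.Nullary using (Dec; yes; no; ⌊_⌋; contradiction)

open import Algebra.Properties.CommutativeSemigroup ℤ.+-commutativeSemigroup
  using (xy∙z≈xz∙y)
open import Algebra.Properties.Semiring.Sum ℤ.+-*-semiring
  using (sum; sum-cong-≗; sum-remove; sum-replicate-zero; ∑-distrib-+; *-distribʳ-sum)

sum-single-support : ∀ {m} (f : Fin m → ℤ) i → (∀ k → k ≢ i → f k ≡ 0ℤ) → sum f ≡ f i
sum-single-support {ℕ.suc m} f i f≡0 = begin
  sum f                      ≡⟨ sum-remove {i = i} f ⟩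
  f i + sum (f ∘ punchIn i)  ≡⟨ cong (_+_ (f i)) rest≡0 ⟩
  f i + 0ℤ                   ≡⟨ ℤ.+-identityʳ (f i) ⟩
  f i                        ∎
  where
  open ≡-Reasoning
  rest≡0 : sum (f ∘ punchIn i) ≡ 0ℤ
  rest≡0 = trans (sum-cong-≗ (λ k → f≡0 _ (punchInᵢ≢i i k))) (sum-replicate-zero m)

sum-nonneg : ∀ {m} {f : Fin m → ℤ} → (∀ k → 0ℤ ≤ f k) → 0ℤ ≤ sum f
sum-nonneg {ℕ.zero}  _   = ℤ.≤-refl
sum-nonneg {ℕ.suc m} f≥0 = ℤ.+-mono-≤ (f≥0 zero) (sum-nonneg (f≥0 ∘ suc))

sum-pos : ∀ {m} (f : Fin m → ℕ) → sum (λ k → + f k) ≡ + List.sum (tabulate f)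
sum-pos {ℕ.zero}  f = refl
sum-pos {ℕ.suc m} f = cong (_+_ (+ f zero)) (sum-pos (f ∘ suc))

m*[n/d]≤m*n/d : ∀ m n d .{{_ : NonZero d}} → m ℕ.* (n ℕ./ d) ℕ.≤ m ℕ.* n ℕ./ d
m*[n/d]≤m*n/d m n d = begin
  m ℕ.* (n ℕ./ d)                ≡⟨ ℕ.m*n/n≡m (m ℕ.* (n ℕ./ d)) d ⟨
  m ℕ.* (n ℕ./ d) ℕ.* d ℕ./ d    ≡⟨ ℕ./-congˡ (ℕ.*-assoc m (n ℕ./ d) d) ⟩
  m ℕ.* (n ℕ./ d ℕ.* d) ℕ./ d    ≤⟨ ℕ./-monoˡ-≤ d (ℕ.*-monoʳ-≤ m (ℕ.m/n*n≤m n d)) ⟩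
  m ℕ.* n ℕ./ d                  ∎
  where open ℕ.≤-Reasoning

0≤i<j⇒∣i∣<∣j∣ : ∀ {i j} → 0ℤ ≤ i → i <ℤ j → ∣ i ∣ < ∣ j ∣
0≤i<j⇒∣i∣<∣j∣ (+≤+ _) (+<+ m<n) = m<n

nonneg-cong : ∀ {m} {D D′ : Config m} → D ≗ D′ → NonNeg D → NonNeg D′
nonneg-cong D≗D′ D≥0 k = ℤ.≤-trans (D≥0 k) (ℤ.≤-reflexive (D≗D′ k))

module Firing (a b c : ℕ) .{{_ : NonZero b}} {n : ℕ} (G : Graph n) where

  φ : Fin n → Config n → Config n
  φ = fire a b c G

  _↠_ : Config n → Config n → Set
  _↠_ = LegalFirings a b c G

  q : Fin n → ℕ
  q i = deg G i ℕ.* a ℕ./ b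

  spent : Fin n → Config n
  spent i k = if ⌊ i ≟ k ⌋ then - + (c ℕ.+ q i) else 0ℤ

  sent : Fin n → Config n
  sent i k = + (if adj G i k then 1 else 0) * + (a ℕ./ b)

  Δ : Fin n → Config n
  Δ i k = spent i k + sent i k

  spent-self : ∀ i → spent i i ≡ - + (c ℕ.+ q i)
  spent-self i with i ≟ i
  ... | yes _   = refl
  ... | no i≢i = contradiction refl i≢i

  spent-off : ∀ i k → k ≢ i → spent i k ≡ 0ℤ
  spent-off i k k≢i with i ≟ k
  ... | yes i≡k = contradiction (sym i≡k) k≢i
  ... | no _    = refl

  fire-translates : ∀ i D k → φ i D k ≡ D k + Δ i k
  fire-translates i D k with i ≟ k
  ... | yes refl rewrite irrefl G i = cong (_+_ (D i)) (sym (ℤ.+-identityʳ _))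
  ... | no _ with adj G i k
  ...   | true  = cong (_+_ (D k)) (sym (trans (ℤ.+-identityˡ _) (ℤ.*-identityˡ _)))
  ...   | false = sym (ℤ.+-identityʳ (D k))

  fire-cong : ∀ i {D D′} → D ≗ D′ → φ i D ≗ φ i D′
  fire-cong i {D} {D′} D≗D′ k = begin
    φ i D k       ≡⟨ fire-translates i D k ⟩
    D k + Δ i k   ≡⟨ cong (_+ Δ i k) (D≗D′ k) ⟩
    D′ k + Δ i k  ≡⟨ fire-translates i D′ k ⟨
    φ i D′ k      ∎
    where open ≡-Reasoning

  fire-comm : ∀ i j D → φ i (φ j D) ≗ φ j (φ i D)
  fire-comm i j D k = begin
    φ i (φ j D) k          ≡⟨ fire-translates i (φ j D) k ⟩
    φ j D k + Δ i k        ≡⟨ cong (_+ Δ i k) (fire-translates j D k) ⟩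
    D k + Δ j k + Δ i k    ≡⟨ xy∙z≈xz∙y (D k) (Δ j k) (Δ i k) ⟩
    D k + Δ i k + Δ j k    ≡⟨ cong (_+ Δ j k) (fire-translates i D k) ⟨
    φ i D k + Δ j k        ≡⟨ fire-translates j (φ i D) k ⟨
    φ j (φ i D) k          ∎
    where open ≡-Reasoning

  fire-mono-off : ∀ i k D → i ≢ k → D k ≤ φ i D k
  fire-mono-off i k D i≢k with i ≟ k
  ... | yes i≡k = contradiction i≡k i≢k
  ... | no _ with adj G i k
  ...   | true  = ℤ.i≤i+j (D k) (+ (a ℕ./ b))
  ...   | false = ℤ.≤-refl

  legal-cong : ∀ i {D D′} → D ≗ D′ → Legal a b c G i D → Legal a b c G i D′
  legal-cong i D≗D′ = nonneg-cong (fire-cong i D≗D′)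

  zeroStable-cong : ∀ {D D′} → D ≗ D′ → ZeroStable a b c G D → ZeroStable a b c G D′
  zeroStable-cong D≗D′ (D≥0 , stuck) =
    nonneg-cong D≗D′ D≥0 , λ i legal → stuck i (legal-cong i (sym ∘ D≗D′) legal)

  legal-preserved : ∀ {i j D} → i ≢ j → Legal a b c G i D → Legal a b c G j D →
                    Legal a b c G i (φ j D)
  -- Firing j only adds chips away from j, so at vertex i it suffices to commute the two firings.
  legal-preserved {i} {j} {D} i≢j legal-i legal-j k with k ≟ i
  ... | no k≢i   = ℤ.≤-trans (legal-j k) (fire-mono-off i k (φ j D) (k≢i ∘ sym))
  ... | yes refl = ℤ.≤-trans (legal-i i)
                     (ℤ.≤-trans (fire-mono-off j i (φ i D) (i≢j ∘ sym))
                                (ℤ.≤-reflexive (fire-comm j i D i)))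

  firings-cong : ∀ {D D′ E} → D ≗ D′ → D ↠ E → Σ (Config n) λ E′ → D′ ↠ E′ × E ≗ E′
  firings-cong {D′ = D′} D≗D′ done = D′ , done , D≗D′
  firings-cong D≗D′ (step i legal rest) =
    let E′ , rest′ , E≗E′ = firings-cong (fire-cong i D≗D′) rest
    in  E′ , step i (legal-cong i D≗D′ legal) rest′ , E≗E′

  fire-first : ∀ {D E} i → D ↠ E → ZeroStable a b c G E → Legal a b c G i D →
               Σ (Config n) λ E′ → φ i D ↠ E′ × E′ ≗ E
  fire-first i done (_ , stuck) legal-i = contradiction legal-i (stuck i)
  fire-first {D} i (step j legal-j rest) E-stable legal-i with i ≟ j
  ... | yes refl = _ , rest , λ _ → refl
  ... | no i≢j =
    let E₁ , rest₁ , E₁≗E = fire-first i rest E-stable (legal-preserved i≢j legal-i legal-j)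
        E₂ , rest₂ , E₁≗E₂ = firings-cong (fire-comm i j D) rest₁
    in  E₂ , step j (legal-preserved (i≢j ∘ sym) legal-j legal-i) rest₂
           , λ k → trans (sym (E₁≗E₂ k)) (E₁≗E k)

  stabilizations-agree : ∀ {D E E′} → D ↠ E → ZeroStable a b c G E →
                         D ↠ E′ → ZeroStable a b c G E′ → E ≗ E′
  stabilizations-agree done _ done _ = λ _ → refl
  stabilizations-agree (step i legal _) _ done (_ , stuck) = contradiction legal (stuck i)
  stabilizations-agree D↠E E-stable (step i legal D↠E′) E′-stable =
    let E₁ , φD↠E₁ , E₁≗E = fire-first i D↠E E-stable legal
    in  λ k → trans (sym (E₁≗E k))
                    (stabilizations-agree φD↠E₁ (zeroStable-cong (sym ∘ E₁≗E) E-stable)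
                                          D↠E′ E′-stable k)

  total : Config n → ℤ
  total = sum

  total-sent : ∀ i → total (sent i) ≡ + (deg G i ℕ.* (a ℕ./ b))
  total-sent i = begin
    sum (sent i)                        ≡⟨ *-distribʳ-sum (+ (a ℕ./ b)) (+_ ∘ neighbour) ⟨
    sum (+_ ∘ neighbour) * + (a ℕ./ b)  ≡⟨ cong (_* + (a ℕ./ b)) count-neighbours ⟩
    + deg G i * + (a ℕ./ b)             ≡⟨ ℤ.pos-* (deg G i) (a ℕ./ b) ⟨
    + (deg G i ℕ.* (a ℕ./ b))           ∎
    where
    open ≡-Reasoning
    neighbour : Fin n → ℕ
    neighbour k = if adj G i k then 1 else 0
    count-neighbours : sum (+_ ∘ neighbour) ≡ + deg G i
    count-neighbours = trans (sum-pos neighbour)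
                             (cong (+_ ∘ List.sum) (sym (map-tabulate (λ k → k) neighbour)))

  total-Δ : ∀ i → total (Δ i) ≡ - + (c ℕ.+ q i) + + (deg G i ℕ.* (a ℕ./ b))
  total-Δ i = begin
    sum (Δ i)                                    ≡⟨ ∑-distrib-+ (spent i) (sent i) ⟩
    sum (spent i) + sum (sent i)                 ≡⟨ cong (_+ sum (sent i)) total-spent ⟩
    - + (c ℕ.+ q i) + sum (sent i)               ≡⟨ cong (_+_ (- + (c ℕ.+ q i))) (total-sent i) ⟩
    - + (c ℕ.+ q i) + + (deg G i ℕ.* (a ℕ./ b))  ∎
    where
    open ≡-Reasoning
    total-spent : sum (spent i) ≡ - + (c ℕ.+ q i)
    total-spent = trans (sum-single-support (spent i) i (spent-off i)) (spent-self i)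

  total-fire : ∀ i D → total (φ i D) ≡ total D + total (Δ i)
  total-fire i D = trans (sum-cong-≗ (fire-translates i D)) (∑-distrib-+ D (Δ i))

  legal? : ∀ i D → Dec (Legal a b c G i D)
  legal? i D = all? (λ k → 0ℤ ≤? φ i D k)

  module _ (c>0 : 0 < c) where

    total-Δ-neg : ∀ i → total (Δ i) <ℤ 0ℤ
    total-Δ-neg i = begin-strict
      total (Δ i)                                  ≡⟨ total-Δ i ⟩
      - + (c ℕ.+ q i) + + (deg G i ℕ.* (a ℕ./ b))  <⟨ ℤ.+-monoʳ-< (- + (c ℕ.+ q i)) (+<+ sent<spent) ⟩
      - + (c ℕ.+ q i) + + (c ℕ.+ q i)              ≡⟨ ℤ.+-inverseˡ (+ (c ℕ.+ q i)) ⟩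
      0ℤ                                           ∎
      where
      open ℤ.≤-Reasoning
      sent<spent : deg G i ℕ.* (a ℕ./ b) < c ℕ.+ q i
      sent<spent = ℕ.≤-<-trans (m*[n/d]≤m*n/d (deg G i) a b) (ℕ.m<n+m (q i) c>0)

    total-fire-< : ∀ i D → total (φ i D) <ℤ total D
    total-fire-< i D = begin-strict
      total (φ i D)            ≡⟨ total-fire i D ⟩
      total D + total (Δ i)    <⟨ ℤ.+-monoʳ-< (total D) (total-Δ-neg i) ⟩
      total D + 0ℤ             ≡⟨ ℤ.+-identityʳ (total D) ⟩
      total D                  ∎
      where open ℤ.≤-Reasoning

    stabilize : ∀ D → NonNeg D → Acc _<_ ∣ total D ∣ →
                Σ (Config n) (ZeroStabilization a b c G D)
    stabilize D D≥0 (acc smaller) with any? (λ i → legal? i D)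
    ... | no none = D , done , D≥0 , λ i legal → none (i , legal)
    ... | yes (i , legal) =
      let E , φD↠E , E-stable = stabilize (φ i D) legal
            (smaller (0≤i<j⇒∣i∣<∣j∣ (sum-nonneg legal) (total-fire-< i D)))
      in  E , step i legal φD↠E , E-stable

theorem2p7 : (a b c : ℕ) → 0 < a → .{{_ : NonZero b}} → 0 < c →
    ∀ {n} (G : Graph n) (D : Config n) → NonNeg D →
    Σ (Config n) (λ E → ZeroStabilization a b c G D E ×
      (∀ E′ → ZeroStabilization a b c G D E′ → ∀ i → E′ i ≡ E i))
theorem2p7 a b c _ c>0 G D D≥0 =
  let E , D↠E , E-stable = stabilize c>0 D D≥0 (<-wellFounded _)
  in  E , (D↠E , E-stable) , λ E′ (D↠E′ , E′-stable) →
        stabilizations-agree D↠E′ E′-stable D↠E E-stable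
  where open Firing a b c G
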